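{- Let $(M,\exists)$ be a monadic algebra and $\Upsilon$ a ubiquity operator on it. Then for all $p,q\in M$, $\Upsilon(p\wedge q)=\Upsilon p\wedge\Upsilon q$.
   Context: A monadic algebra is a Boolean algebra $M$ (operations $\wedge,\vee,{}'$, constants $0,1$, order $\le$) together with a map $\exists:M\to M$ such that $\exists 0=0$, $p\le\exists p$, and $\exists(p\wedge\exists q)=\exists p\wedge\exists q$ for all $p,q$. Write $\forall p:=(\exists p')'$. A ubiquity operator on $M$ is a map $\Upsilon:M\to M$ such that for all $p,q\in M$: (i) $\Upsilon p\wedge\Upsilon q\le\Upsilon(p\wedge q)$; (ii) $\Upsilon p\le\Upsilon(p\vee q)$; (iii) $\forall p\le\Upsilon p\le\exists p$. -}

module Defs where

open import Level using (Level)
open import Algebra.Core using (Op₁)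
open import Algebra.Lattice.Bundles using (BooleanAlgebra)
open import Data.Product using (_×_)

module _ {c ℓ : Level} (B : BooleanAlgebra c ℓ) where
  open BooleanAlgebra B

  _≤_ : Carrier → Carrier → Set ℓ
  p ≤ q = (p ∧ q) ≈ p

  record IsQuantifier (ex : Op₁ Carrier) : Set (c Level.⊔ ℓ) where
    field
      cong     : ∀ {p q} → p ≈ q → ex p ≈ ex q
      ex-⊥     : ex ⊥ ≈ ⊥
      ex-incr  : ∀ p → p ≤ ex p
      ex-mod   : ∀ p q → ex (p ∧ ex q) ≈ (ex p ∧ ex q)

  univ : Op₁ Carrier → Op₁ Carrier
  univ ex p = ¬ (ex (¬ p))

  record IsUbiquity (ex : Op₁ Carrier) (U : Op₁ Carrier) : Set (c Level.⊔ ℓ) where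
    field
      cong     : ∀ {p q} → p ≈ q → U p ≈ U q
      U-∧      : ∀ p q → (U p ∧ U q) ≤ U (p ∧ q)
      U-∨      : ∀ p q → U p ≤ U (p ∨ q)
      U-lower  : ∀ p → univ ex p ≤ U p
      U-upper  : ∀ p → U p ≤ ex p

-- Only axioms (i) and (ii) matter: (ii) makes Υ monotone, so Υ(p ∧ q) lies below both Υ p
-- and Υ q, and (i) is the reverse inequality.
module Submission where

open import Defs using (IsQuantifier; IsUbiquity)
import Defs
open import Level using (Level)
open import Algebra.Core using (Op₁)
open import Algebra.Lattice.Bundles using (BooleanAlgebra)
import Algebra.Lattice.Properties.Lattice as LatticeProperties
open import Relation.Binary.Core using (_Preserves_⟶_)
open import Relation.Binary.Lattice using (MeetSemilattice; Lattice)
import Relation.Binary.Reasoning.Setoid as ≈-Reasoning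

module _ {c ℓ₁ ℓ₂ : Level} (M : MeetSemilattice c ℓ₁ ℓ₂) where
  open MeetSemilattice M

  monotone-supermultiplicative⇒∧-homo : (f : Carrier → Carrier) →
    f Preserves _≤_ ⟶ _≤_ → (∀ x y → (f x ∧ f y) ≤ f (x ∧ y)) →
    ∀ x y → f (x ∧ y) ≈ (f x ∧ f y)
  monotone-supermultiplicative⇒∧-homo f mono super x y =
    antisym (∧-greatest (mono (x∧y≤x x y)) (mono (x∧y≤y x y))) (super x y)

module _ {c ℓ : Level} (B : BooleanAlgebra c ℓ) where
  open BooleanAlgebra B
  open LatticeProperties lattice using (∨-∧-orderTheoreticLattice)
  open Lattice ∨-∧-orderTheoreticLattice using (meetSemilattice) renaming (_≤_ to _≤ₙ_)

  -- The library's natural order reads p ≈ p ∧ q, the symmetric form of Defs._≤_.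
  ≤⇒≤ₙ : ∀ {p q} → Defs._≤_ B p q → p ≤ₙ q
  ≤⇒≤ₙ = sym

  ≤ₙ⇒∨≈ : ∀ {p q} → p ≤ₙ q → (p ∨ q) ≈ q
  ≤ₙ⇒∨≈ {p} {q} p≈p∧q = begin
    p ∨ q        ≈⟨ ∨-congʳ p≈p∧q ⟩
    (p ∧ q) ∨ q  ≈⟨ ∨-comm _ _ ⟩
    q ∨ (p ∧ q)  ≈⟨ ∨-congˡ (∧-comm p q) ⟩
    q ∨ (q ∧ p)  ≈⟨ ∨-absorbs-∧ q p ⟩
    q            ∎
    where open ≈-Reasoning setoid

  module _ {ex U : Op₁ Carrier} (Υ : IsUbiquity B ex U) where
    open IsUbiquity Υ

    ubiquity-monotone : U Preserves _≤ₙ_ ⟶ _≤ₙ_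
    ubiquity-monotone {p} {q} p≤q = ≤⇒≤ₙ (trans (∧-congˡ (cong (sym (≤ₙ⇒∨≈ p≤q)))) (U-∨ p q))

    ubiquity-∧-homo : ∀ p q → U (p ∧ q) ≈ (U p ∧ U q)
    ubiquity-∧-homo = monotone-supermultiplicative⇒∧-homo meetSemilattice U ubiquity-monotone
      (λ p q → ≤⇒≤ₙ (U-∧ p q))

mainTheorem10 : {c ℓ : Level} (B : BooleanAlgebra c ℓ) (ex U : Op₁ (BooleanAlgebra.Carrier B)) →
    IsQuantifier B ex → IsUbiquity B ex U →
    ∀ p q → BooleanAlgebra._≈_ B (U (BooleanAlgebra._∧_ B p q)) (BooleanAlgebra._∧_ B (U p) (U q))
mainTheorem10 B ex U _ Υ = ubiquity-∧-homo B Υ
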